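{- For all positive integers $n$ and $r$, $\mu(n,r)\le n-\left\lfloor\frac{n}{\lfloor r!e\rfloor}\right\rfloor$.
   Context: A set $S$ of integers is sum-free if there are no $x,y,z\in S$ (with $x=y$ allowed) satisfying $x+y=z$. $\mu(n,r)$ is the largest size of a set $S\subseteq[n]$ that admits an $r$-colouring in which every colour class is sum-free (equivalently, $S$ can be partitioned into $r$ sum-free sets). $e$ is Euler's number. -}

module Defs where

open import Data.Nat using (ℕ; zero; suc; _+_; _/_; _!; NonZero; >-nonZero; _≤_)
open import Data.Nat.Properties using (_!≢0; m≤m+n; 1≤n!; ≤-trans)
open import Data.Nat.DivMod using (n/1≡n)
open import Data.List using (List; map; upTo)
open import Data.Nat.ListAction using (sum)
open import Data.Fin using (Fin; toℕ)
open import Data.Fin.Subset using (Subset; _∈_)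
open import Data.Product using (Σ; _×_)
open import Relation.Binary.PropositionalEquality using (_≡_; _≢_; subst; sym)

-- The integer i ∈ [n] = {1,…,n} represented by x : Fin n is toℕ x + 1.
val : ∀ {n} → Fin n → ℕ
val x = suc (toℕ x)

SumFree : ∀ {n} → (Fin n → Set) → Set
SumFree {n} P = ∀ (x y z : Fin n) → P x → P y → P z → val x + val y ≢ val z

-- S ⊆ [n] can be partitioned into r sum-free sets: there is an
-- r-colouring c of S (here of all of [n], only the restriction to S matters)
-- such that every colour class S ∩ c⁻¹(i) is sum-free.
PartitionableSumFree : ∀ {n} → (r : ℕ) → Subset n → Set
PartitionableSumFree {n} r S =
  Σ (Fin n → Fin r) (λ c → ∀ (i : Fin r) → SumFree (λ x → (x ∈ S) × (c x ≡ i)))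

-- ⌊ r! e ⌋ for r ≥ 1 equals Σ_{k=0}^{r} r!/k!  (since the tail
-- Σ_{k>r} r!/k! lies in (0,1) when r ≥ 1).
floorFactE : ℕ → ℕ
floorFactE r = sum (map (λ k → _/_ (r !) (k !) {{k !≢0}}) (upTo (suc r)))

floorFactE≢0 : ∀ r → NonZero (floorFactE r)
floorFactE≢0 r = >-nonZero (≤-trans (subst (1 ≤_) (sym (n/1≡n (r !))) (1≤n! r)) (m≤m+n _ _))

{-# OPTIONS --safe #-}

-- Let m = n − |S| count the elements of [n] missing from S, and N k = ⌊k! e⌋, so that
-- N 0 = 1 and N (k+1) = (k+1) N k + 1. Call a strictly increasing list Y ⊆ {0,…,n} a chain
-- with palette C if every difference b − a (a < b in Y) lying in S has its colour in C.
-- Such a chain has at most (m+1) N |C| elements. After its least element v, at most m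
-- elements y have y − v ∉ S, these offsets being distinct. For each colour j, the y with
-- y − v of colour j form a chain with palette C ∖ {j}: as (a − v) + (b − a) = b − v and
-- colour class j is sum-free, b − a cannot have colour j. Finally the chain 0, 1, …, n
-- with all r colours gives n + 1 ≤ (m+1) N r, that is ⌊n / N r⌋ ≤ m.

module Submission where

open import Defs
open import Data.Nat
open import Data.Nat.Properties
open import Data.Nat.DivMod using (m<n*o⇒m/o<n; n/n≡1; *-/-assoc)
open import Data.Nat.Divisibility using (m≤n⇒m!∣n!)
open import Data.Nat.ListAction using (sum)
open import Data.Nat.ListAction.Properties using (sum-++)
open import Data.Nat.Tactic.RingSolver using (solve-∀)
open import Algebra.Properties.CommutativeSemigroup +-commutativeSemigroup using (x∙yz≈y∙xz)
open import Data.Fin using (Fin; fromℕ<)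
import Data.Fin.Properties as Fin
open import Data.Fin.Subset using (Subset; ∁; _-_; ∣_∣) renaming (_∈_ to _∈ₛ_)
open import Data.Fin.Subset.Properties
  using (_∈?_; ∣p∣≤n; ∣∁p∣≡n∸∣p∣; x∉p⇒x∈∁p; x∈p∧x≢y⇒x∈p-y; x∈p⇒∣p-x∣<∣p∣)
open import Data.List using (List; []; _∷_; _++_; _∷ʳ_; length; map; filter; upTo; allFin)
open import Data.List.Properties
  using (length-map; length-upTo; length-tabulate; upTo-∷ʳ; map-++; map-cong-local; filter-notAll)
open import Data.List.Membership.Propositional using (_∈_)
open import Data.List.Membership.Propositional.Properties using (∈-filter⁺; ∈-filter⁻; ∈-allFin)
open import Data.List.Relation.Binary.Subset.Propositional using (_⊆_)
open import Data.List.Relation.Binary.Subset.Propositional.Properties using (filter-⊆; ∷⁺ʳ)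
open import Data.List.Relation.Unary.All using (All; []; _∷_; lookup)
import Data.List.Relation.Unary.All as All
import Data.List.Relation.Unary.All.Properties as All
open import Data.List.Relation.Unary.AllPairs using (AllPairs; []; _∷_)
import Data.List.Relation.Unary.AllPairs.Properties as AllPairs
import Data.List.Relation.Unary.Any as Any
open import Data.List.Relation.Unary.Any using (here; there)
open import Data.List.Relation.Unary.Unique.Propositional using (Unique)
open import Data.Bool using (true; false)
open import Data.Product using (∃-syntax; _×_; _,_)
open import Function using (_∘_; case_of_)
open import Level using (Level)
open import Relation.Nullary using (¬_; Dec; does; ¬?; _×-dec_; contradiction)
open import Relation.Unary using (Pred; Decidable)
open import Relation.Unary.Properties using (∁?)
open import Relation.Binary.PropositionalEquality

private variable
  a p : Level
  A : Set a

length-filter+filter-∁ : {P : Pred A p} (P? : Decidable P) (xs : List A) →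
  length xs ≡ length (filter P? xs) + length (filter (∁? P?) xs)
length-filter+filter-∁ P? [] = refl
length-filter+filter-∁ P? (x ∷ xs) with does (P? x) | length-filter+filter-∁ P? xs
... | true  | eq = cong suc eq
... | false | eq = trans (cong suc eq) (sym (+-suc _ _))

sum-map-*ˡ : ∀ c (f : A → ℕ) xs → sum (map (λ x → c * f x) xs) ≡ c * sum (map f xs)
sum-map-*ˡ c f [] = sym (*-zeroʳ c)
sum-map-*ˡ c f (x ∷ xs) = trans (cong (c * f x +_) (sum-map-*ˡ c f xs)) (sym (*-distribˡ-+ c (f x) _))

[m∸n]+[o∸m]≡o∸n : ∀ {m n o} → n ≤ m → m ≤ o → (m ∸ n) + (o ∸ m) ≡ o ∸ n
[m∸n]+[o∸m]≡o∸n {m} {n} {o} n≤m m≤o = begin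
  (m ∸ n) + (o ∸ m)   ≡⟨ +-comm (m ∸ n) (o ∸ m) ⟩
  (o ∸ m) + (m ∸ n)   ≡⟨ +-∸-assoc (o ∸ m) n≤m ⟨
  (o ∸ m) + m ∸ n     ≡⟨ cong (_∸ n) (m∸n+n≡m m≤o) ⟩
  o ∸ n               ∎
  where open ≡-Reasoning

factRatio : ℕ → ℕ → ℕ
factRatio k i = _/_ (k !) (i !) {{i !≢0}}

floorFactE-suc : ∀ k → floorFactE (suc k) ≡ suc (suc k * floorFactE k)
floorFactE-suc k = begin
  floorFactE (suc k)
    ≡⟨ cong (sum ∘ map (factRatio (suc k))) (upTo-∷ʳ (suc k)) ⟨
  sum (map (factRatio (suc k)) (upTo (suc k) ∷ʳ suc k))
    ≡⟨ cong sum (map-++ (factRatio (suc k)) (upTo (suc k)) _) ⟩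
  sum (map (factRatio (suc k)) (upTo (suc k)) ++ factRatio (suc k) (suc k) ∷ [])
    ≡⟨ sum-++ (map (factRatio (suc k)) (upTo (suc k))) _ ⟩
  sum (map (factRatio (suc k)) (upTo (suc k))) + (factRatio (suc k) (suc k) + 0)
    ≡⟨ cong₂ _+_ (cong sum (map-cong-local ratios-scale))
                 (cong (_+ 0) (n/n≡1 (suc k !) {{suc k !≢0}})) ⟩
  sum (map (λ i → suc k * factRatio k i) (upTo (suc k))) + 1
    ≡⟨ cong (_+ 1) (sum-map-*ˡ (suc k) (factRatio k) (upTo (suc k))) ⟩
  suc k * floorFactE k + 1
    ≡⟨ +-comm _ 1 ⟩
  suc (suc k * floorFactE k) ∎
  where
  open ≡-Reasoning
  ratios-scale : All (λ i → factRatio (suc k) i ≡ suc k * factRatio k i) (upTo (suc k))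
  ratios-scale = All.applyUpTo⁺₁ (λ i → i) (suc k) λ {i} i<1+k →
    *-/-assoc (suc k) {{i !≢0}} (m≤n⇒m!∣n! (s≤s⁻¹ i<1+k))

chainBound : ℕ → ℕ → ℕ
chainBound m k = suc m * floorFactE k

chainBound-suc : ∀ m k → suc (m + suc k * chainBound m k) ≡ chainBound m (suc k)
chainBound-suc m k = begin
  suc (m + suc k * (suc m * floorFactE k)) ≡⟨ distribute m (suc k) (floorFactE k) ⟩
  suc m * suc (suc k * floorFactE k)       ≡⟨ cong (suc m *_) (floorFactE-suc k) ⟨
  chainBound m (suc k)                     ∎
  where
  open ≡-Reasoning
  distribute : ∀ m k N → suc (m + k * (suc m * N)) ≡ suc m * suc (k * N)
  distribute = solve-∀

_∖_ : ∀ {r} → List (Fin r) → Fin r → List (Fin r)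
C ∖ j = filter (λ i → ¬? (i Fin.≟ j)) C

length-∖ : ∀ {r k} {C : List (Fin r)} {j} → j ∈ C → length C ≤ suc k → length (C ∖ j) ≤ k
length-∖ {C = C} j∈C |C|≤1+k =
  s≤s⁻¹ (≤-trans (filter-notAll _ C (Any.map (λ j≡i i≢j → i≢j (sym j≡i)) j∈C)) |C|≤1+k)

val-onto : ∀ {n d} → 0 < d → d ≤ n → ∃[ x ] val {n} x ≡ d
val-onto {d = suc d} _ d<n = fromℕ< d<n , cong suc (Fin.toℕ-fromℕ< d<n)

unique-values-length≤∣∣ : ∀ {n} (p : Subset n) {ds : List ℕ} → Unique ds →
  All (λ d → ∃[ x ] val x ≡ d × x ∈ₛ p) ds → length ds ≤ ∣ p ∣
unique-values-length≤∣∣ p [] [] = z≤n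
unique-values-length≤∣∣ p (d∉ds ∷ ds!) ((x , refl , x∈p) ∷ ds∈p) =
  ≤-trans (s≤s (unique-values-length≤∣∣ (p - x) ds! (All.zipWith in-p-x (d∉ds , ds∈p))))
          (x∈p⇒∣p-x∣<∣p∣ x∈p)
  where
  in-p-x : ∀ {d} → val x ≢ d × ∃[ y ] val y ≡ d × y ∈ₛ p → ∃[ y ] val y ≡ d × y ∈ₛ p - x
  in-p-x (x≢d , y , refl , y∈p) = y , refl , x∈p∧x≢y⇒x∈p-y y∈p (λ { refl → x≢d refl })

offsets-unique : ∀ {v ys} → AllPairs _<_ (v ∷ ys) → Unique (map (_∸ v) ys)
offsets-unique (_ ∷ []) = []
offsets-unique ((v<y ∷ v<ys) ∷ (y<ys ∷ ys↑)) =
  All.map⁺ (All.zipWith (λ (v<z , y<z) → <⇒≢ (∸-monoˡ-< y<z (<⇒≤ v<y)))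
                        (v<ys , y<ys))
  ∷ offsets-unique (v<ys ∷ ys↑)

AllPairs-filter-tail : ∀ {R : A → A → Set} {P : Pred A p} (P? : Decidable P) {x xs} →
  AllPairs R (x ∷ xs) → AllPairs R (x ∷ filter P? xs)
AllPairs-filter-tail P? (Rx ∷ xs!) = All.filter⁺ P? Rx ∷ AllPairs.filter⁺ P? xs!

module _ {n r} (S : Subset n) (c : Fin n → Fin r) where

  missing : ℕ
  missing = ∣ ∁ S ∣

  Coloured : Fin r → ℕ → Set
  Coloured j d = ∃[ x ] val x ≡ d × x ∈ₛ S × c x ≡ j

  coloured? : ∀ j d → Dec (Coloured j d)
  coloured? j d = Fin.any? λ x → val x ≟ d ×-dec x ∈? S ×-dec c x Fin.≟ j

  DifferencePalette : List (Fin r) → List ℕ → Set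
  DifferencePalette C Y = ∀ {a b j} → a ∈ Y → b ∈ Y → a < b → Coloured j (b ∸ a) → j ∈ C

  ChainsBounded : ℕ → Set
  ChainsBounded k = ∀ {C Y} → length C ≤ k → AllPairs _<_ Y → All (_≤ n) Y →
    DifferencePalette C Y → length Y ≤ chainBound missing k

  palette-mono : ∀ {C Y Y′} → Y′ ⊆ Y → DifferencePalette C Y → DifferencePalette C Y′
  palette-mono Y′⊆Y pal a∈ b∈ = pal (Y′⊆Y a∈) (Y′⊆Y b∈)

  uncoloured-offsets-length≤ : ∀ {v ys} → AllPairs _<_ (v ∷ ys) → All (_≤ n) ys →
    (∀ {y j} → y ∈ ys → ¬ Coloured j (y ∸ v)) → length ys ≤ missing
  uncoloured-offsets-length≤ {v} {ys} ys↑@(v<ys ∷ _) ys≤n uncoloured = begin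
    length ys               ≡⟨ length-map (_∸ v) ys ⟨
    length (map (_∸ v) ys)  ≤⟨ unique-values-length≤∣∣ (∁ S) (offsets-unique ys↑)
                                 (All.map⁺ (All.tabulate offset-outside-S)) ⟩
    missing                 ∎
    where
    open ≤-Reasoning
    offset-outside-S : ∀ {y} → y ∈ ys → ∃[ x ] val x ≡ y ∸ v × x ∈ₛ ∁ S
    offset-outside-S y∈
      with x , x≡ ← val-onto (m<n⇒0<n∸m (lookup v<ys y∈)) (≤-trans (m∸n≤m _ v) (lookup ys≤n y∈)) =
      x , x≡ , x∉p⇒x∈∁p (λ x∈S → uncoloured y∈ (x , x≡ , x∈S , refl))

  module _ (sum-free : ∀ i → SumFree (λ x → (x ∈ₛ S) × (c x ≡ i))) where

    coloured-sum-free : ∀ {j d e} → Coloured j d → Coloured j e → ¬ Coloured j (d + e)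
    coloured-sum-free (x , refl , x∈S , cx≡j) (y , refl , y∈S , cy≡j) (z , z≡ , z∈S , cz≡j) =
      sum-free _ x y z (x∈S , cx≡j) (y∈S , cy≡j) (z∈S , cz≡j) (sym z≡)

    monochromatic-palette : ∀ {C v ys j} → DifferencePalette C (v ∷ ys) → All (v <_) ys →
      All (λ y → Coloured j (y ∸ v)) ys → DifferencePalette (C ∖ j) ys
    monochromatic-palette {v = v} {j = j} pal v<ys cols {a} {b} {i} a∈ b∈ a<b col =
      ∈-filter⁺ _ (pal (there a∈) (there b∈) a<b col) i≢j
      where
      i≢j : i ≢ j
      i≢j refl = coloured-sum-free (lookup cols a∈) col
        (subst (Coloured j) (sym ([m∸n]+[o∸m]≡o∸n (<⇒≤ (lookup v<ys a∈)) (<⇒≤ a<b)))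
               (lookup cols b∈))

    monochromatic-length≤ : ∀ {k} → ChainsBounded k → ∀ {C v ys j} → length C ≤ suc k →
      AllPairs _<_ (v ∷ ys) → All (_≤ n) ys → DifferencePalette C (v ∷ ys) →
      All (λ y → Coloured j (y ∸ v)) ys → length ys ≤ chainBound missing k
    monochromatic-length≤ bounded _ _ _ _ [] = z≤n
    monochromatic-length≤ bounded |C|≤1+k ((v<w ∷ v<ys) ∷ ys↑) ys≤n pal cols@(w-col ∷ _) =
      bounded (length-∖ (pal (here refl) (there (here refl)) v<w w-col) |C|≤1+k) ys↑ ys≤n
        (monochromatic-palette pal (v<w ∷ v<ys) cols)

    offsets-length≤ : ∀ {k} → ChainsBounded k → ∀ {C v} D {ys} → length C ≤ suc k →
      AllPairs _<_ (v ∷ ys) → All (_≤ n) ys → DifferencePalette C (v ∷ ys) →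
      (∀ {y j} → y ∈ ys → Coloured j (y ∸ v) → j ∈ D) →
      length ys ≤ missing + length D * chainBound missing k
    offsets-length≤ bounded [] _ ys↑ ys≤n _ cols =
      ≤-trans (uncoloured-offsets-length≤ ys↑ ys≤n λ y∈ col → case cols y∈ col of λ ())
              (m≤m+n missing 0)
    offsets-length≤ {k} bounded {C} {v} (j ∷ D) {ys} |C|≤1+k ys↑ ys≤n pal cols = begin
      length ys
        ≡⟨ length-filter+filter-∁ coloured-j? ys ⟩
      length (filter coloured-j? ys) + length (filter (∁? coloured-j?) ys)
        ≤⟨ +-mono-≤ class-j rest ⟩
      chainBound missing k + (missing + length D * chainBound missing k)
        ≡⟨ x∙yz≈y∙xz (chainBound missing k) missing _ ⟩
      missing + length (j ∷ D) * chainBound missing k ∎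
      where
      open ≤-Reasoning
      coloured-j? : Decidable (λ y → Coloured j (y ∸ v))
      coloured-j? y = coloured? j (y ∸ v)
      class-j : length (filter coloured-j? ys) ≤ chainBound missing k
      class-j = monochromatic-length≤ bounded |C|≤1+k (AllPairs-filter-tail coloured-j? ys↑)
        (All.filter⁺ coloured-j? ys≤n) (palette-mono (∷⁺ʳ v (filter-⊆ coloured-j? ys)) pal)
        (All.all-filter coloured-j? ys)
      rest : length (filter (∁? coloured-j?) ys) ≤ missing + length D * chainBound missing k
      rest = offsets-length≤ bounded D |C|≤1+k (AllPairs-filter-tail (∁? coloured-j?) ys↑)
        (All.filter⁺ (∁? coloured-j?) ys≤n)
        (palette-mono (∷⁺ʳ v (filter-⊆ (∁? coloured-j?) ys)) pal) rest-colours
        where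
        rest-colours : ∀ {y i} → y ∈ filter (∁? coloured-j?) ys → Coloured i (y ∸ v) → i ∈ D
        rest-colours y∈ col
          with y∈ys , not-j ← ∈-filter⁻ (∁? coloured-j?) y∈ with cols y∈ys col
        ... | here refl = contradiction col not-j
        ... | there i∈D = i∈D

    chains-bounded : ∀ k → ChainsBounded k
    chains-bounded k {Y = []} _ _ _ _ = z≤n
    chains-bounded zero {[]} {v ∷ ys} _ Y↑@(v<ys ∷ _) (_ ∷ ys≤n) pal =
      s≤s (≤-trans (uncoloured-offsets-length≤ Y↑ ys≤n no-colour)
                   (≤-reflexive (sym (*-identityʳ missing))))
      where
      no-colour : ∀ {y j} → y ∈ ys → ¬ Coloured j (y ∸ v)
      no-colour y∈ col with () ← pal (here refl) (there y∈) (lookup v<ys y∈) col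
    chains-bounded (suc k) {C} {v ∷ ys} |C|≤1+k Y↑@(v<ys ∷ _) (_ ∷ ys≤n) pal = begin
      suc (length ys)
        ≤⟨ s≤s (offsets-length≤ (chains-bounded k) C |C|≤1+k Y↑ ys≤n pal
                 λ y∈ → pal (here refl) (there y∈) (lookup v<ys y∈)) ⟩
      suc (missing + length C * chainBound missing k)
        ≤⟨ s≤s (+-monoʳ-≤ missing (*-monoˡ-≤ (chainBound missing k) |C|≤1+k)) ⟩
      suc (missing + suc k * chainBound missing k)
        ≡⟨ chainBound-suc missing k ⟩
      chainBound missing (suc k) ∎
      where open ≤-Reasoning

    n<chainBound : n < chainBound missing r
    n<chainBound = subst (_≤ chainBound missing r) (length-upTo (suc n))
      (chains-bounded r (≤-reflexive (length-tabulate (λ i → i)))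
        (AllPairs.applyUpTo⁺₁ (λ i → i) (suc n) λ i<j _ → i<j)
        (All.applyUpTo⁺₁ (λ i → i) (suc n) s≤s⁻¹)
        λ _ _ _ _ → ∈-allFin _)

theorem4p9 : ∀ (n r : ℕ) → 1 ≤ n → 1 ≤ r →
    ∀ (S : Subset n) → PartitionableSumFree r S →
      ∣ S ∣ ≤ n ∸ _/_ n (floorFactE r) {{floorFactE≢0 r}}
theorem4p9 n r _ _ S (c , sum-free) = begin
  ∣ S ∣               ≡⟨ m∸[m∸n]≡n (∣p∣≤n S) ⟨
  n ∸ (n ∸ ∣ S ∣)     ≤⟨ ∸-monoʳ-≤ n n/N≤n∸∣S∣ ⟩
  n ∸ n / floorFactE r ∎
  where
  open ≤-Reasoning
  instance _ = floorFactE≢0 r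
  n/N≤n∸∣S∣ : n / floorFactE r ≤ n ∸ ∣ S ∣
  n/N≤n∸∣S∣ = subst (n / floorFactE r ≤_) (∣∁p∣≡n∸∣p∣ S)
    (s≤s⁻¹ (m<n*o⇒m/o<n (n<chainBound S c sum-free)))
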